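{- Let $G$ be a split graph with a partition $C,I$ of its vertices, where $C$ is a clique and $I$ is an independent set. Then $G$ is a block graph if and only if (1) every vertex in $I$ with degree at least $2$ is adjacent to all vertices in $C$, and (2) there is at most one vertex in $I$ with degree at least $2$.
   Context: A graph $G$ is a split graph if $V(G)$ can be partitioned into a clique $C$ and an independent set $I$. A graph is a block graph if every biconnected component of it is a clique. -}

module Defs where

open import Data.Nat using (ℕ; _≤_)
open import Data.Fin using (Fin; _≟_)
open import Data.Bool using (Bool; true; false; _∧_; not; if_then_else_)
open import Data.List using (List; map; allFin)
open import Data.Nat.ListAction using (sum)
open import Data.Product using (Σ; ∃; _×_)
open import Relation.Nullary using (¬_)
open import Relation.Nullary.Decidable using (⌊_⌋)
open import Relation.Binary.PropositionalEquality using (_≡_)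

record Graph (n : ℕ) : Set where
  field
    adj    : Fin n → Fin n → Bool
    sym    : ∀ u v → adj u v ≡ adj v u
    irrefl : ∀ v → adj v v ≡ false
open Graph public

Edge : ∀ {n} → Graph n → Fin n → Fin n → Set
Edge G u v = adj G u v ≡ true

VSet : ℕ → Set
VSet n = Fin n → Bool

_∈ₛ_ : ∀ {n} → Fin n → VSet n → Set
v ∈ₛ S = S v ≡ true

_⊆ₛ_ : ∀ {n} → VSet n → VSet n → Set
S ⊆ₛ T = ∀ v → v ∈ₛ S → v ∈ₛ T

compl : ∀ {n} → VSet n → VSet n
compl S v = not (S v)

_∖ₛ_ : ∀ {n} → VSet n → Fin n → VSet n
(S ∖ₛ v) u = S u ∧ not ⌊ u ≟ v ⌋

deg : ∀ {n} → Graph n → Fin n → ℕ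
deg {n} G v = sum (map (λ u → if adj G v u then 1 else 0) (allFin n))

IsClique : ∀ {n} → Graph n → VSet n → Set
IsClique G S = ∀ u v → u ∈ₛ S → v ∈ₛ S → ¬ (u ≡ v) → Edge G u v

IsIndependent : ∀ {n} → Graph n → VSet n → Set
IsIndependent G S = ∀ u v → u ∈ₛ S → v ∈ₛ S → ¬ Edge G u v

data ConnIn {n} (G : Graph n) (S : VSet n) : Fin n → Fin n → Set where
  here : ∀ {x} → x ∈ₛ S → ConnIn G S x x
  step : ∀ {x y z} → x ∈ₛ S → Edge G x y → ConnIn G S y z → ConnIn G S x z

ConnectedSet : ∀ {n} → Graph n → VSet n → Set
ConnectedSet G S = ∀ x y → x ∈ₛ S → y ∈ₛ S → ConnIn G S x y

Biconnected : ∀ {n} → Graph n → VSet n → Set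
Biconnected G S =
  (∃ λ v → v ∈ₛ S) × ConnectedSet G S × (∀ v → v ∈ₛ S → ConnectedSet G (S ∖ₛ v))

Block : ∀ {n} → Graph n → VSet n → Set
Block G S = Biconnected G S × (∀ T → Biconnected G T → S ⊆ₛ T → T ⊆ₛ S)

IsBlockGraph : ∀ {n} → Graph n → Set
IsBlockGraph G = ∀ S → Block G S → IsClique G S

-- A set made of the clique C together with independent vertices that each have two neighbours
-- in C is biconnected: every vertex reaches the clique, and deleting one vertex leaves each
-- independent vertex a neighbour in the clique. In a block graph every biconnected set lies in a
-- block, hence is a clique; applied to C ∪ {v} and C ∪ {v, w} this gives (1) and (2). Conversely,
-- two non-adjacent vertices of a biconnected set both have degree at least 2, so by (1) and (2)
-- they can lie neither on opposite sides nor both in I.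
module Submission where

open import Defs
open import Data.Nat using (ℕ; zero; suc; _≤_; z≤n; s≤s; s≤s⁻¹)
open import Data.Bool using (Bool; true; false; _∨_; not; if_then_else_)
open import Data.Bool.Properties using (∨-zeroʳ) renaming (_≟_ to _≟ᵇ_)
open import Data.Fin using (Fin; zero; suc; _≟_)
open import Data.Fin.Properties using (suc-injective)
open import Data.Fin.Subset using (_⊂_) renaming (_∈_ to _∈ᵥ_)
open import Data.Fin.Subset.Induction using (⊃-wellFounded)
open import Data.List using (map; tabulate)
open import Data.List.Properties using (map-tabulate)
open import Data.Nat.ListAction using (sum)
open import Data.Product using (_×_; _,_; ∃; ∃₂; proj₁; proj₂)
open import Data.Sum using (_⊎_; inj₁; inj₂)
open import Data.Vec using () renaming (tabulate to tabulateᵥ)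
open import Data.Vec.Properties using (lookup⇒[]=; []=⇒lookup; lookup∘tabulate)
open import Function using (_∘_; id; flip)
open import Function.Bundles using (_⇔_; mk⇔; Equivalence)
open import Induction.WellFounded using (WellFounded; Acc; acc; module Subrelation)
import Relation.Binary.Construct.On as On
open import Relation.Binary.PropositionalEquality
  using (_≡_; _≢_; refl; trans; cong) renaming (sym to ≡-sym)
open import Relation.Nullary using (¬_; yes; no; contradiction)
open import Relation.Nullary.Decidable using (⌊_⌋; decidable-stable)

private
  variable
    n : ℕ
    S T : VSet n
    u v w : Fin n

insert : Fin n → VSet n → VSet n
insert v S x = ⌊ x ≟ v ⌋ ∨ S x

∈-insert-here : ∀ (v : Fin n) S → v ∈ₛ insert v S
∈-insert-here v S with v ≟ v
... | yes _   = refl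
... | no v≢v  = contradiction refl v≢v

∈-insert-there : ∀ (v : Fin n) S → u ∈ₛ S → u ∈ₛ insert v S
∈-insert-there {u = u} v S u∈S rewrite u∈S = ∨-zeroʳ ⌊ u ≟ v ⌋

∈-insert⁻ : ∀ (u v : Fin n) S → u ∈ₛ insert v S → u ≡ v ⊎ u ∈ₛ S
∈-insert⁻ u v S u∈ with u ≟ v
... | yes u≡v = inj₁ u≡v
... | no _    = inj₂ u∈

∈-∖ₛ : ∀ S → u ∈ₛ S → u ≢ v → u ∈ₛ (S ∖ₛ v)
∈-∖ₛ {u = u} {v = v} S u∈S u≢v rewrite u∈S with u ≟ v
... | yes u≡v = contradiction u≡v u≢v
... | no _    = refl

∈-∖ₛ⁻ : ∀ S → u ∈ₛ (S ∖ₛ v) → u ∈ₛ S × u ≢ v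
∈-∖ₛ⁻ {u = u} {v = v} S u∈ with S u | u ≟ v
... | true | no u≢v = refl , u≢v

_⊂ₛ_ : VSet n → VSet n → Set
S ⊂ₛ T = S ⊆ₛ T × ∃ λ v → v ∈ₛ T × ¬ v ∈ₛ S

∈ₛ⇒∈ᵥ : v ∈ₛ S → v ∈ᵥ tabulateᵥ S
∈ₛ⇒∈ᵥ {v = v} {S} v∈S = lookup⇒[]= v (tabulateᵥ S) (trans (lookup∘tabulate S v) v∈S)

∈ᵥ⇒∈ₛ : v ∈ᵥ tabulateᵥ S → v ∈ₛ S
∈ᵥ⇒∈ₛ {v = v} {S} v∈ = trans (≡-sym (lookup∘tabulate S v)) ([]=⇒lookup v∈)

⊂ₛ⇒⊂ : S ⊂ₛ T → tabulateᵥ S ⊂ tabulateᵥ T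
⊂ₛ⇒⊂ (S⊆T , v , v∈T , v∉S) = (∈ₛ⇒∈ᵥ ∘ S⊆T _ ∘ ∈ᵥ⇒∈ₛ) , v , ∈ₛ⇒∈ᵥ v∈T , v∉S ∘ ∈ᵥ⇒∈ₛ

⊃ₛ-wellFounded : WellFounded (flip (_⊂ₛ_ {n}))
⊃ₛ-wellFounded = Subrelation.wellFounded ⊂ₛ⇒⊂ (On.wellFounded tabulateᵥ ⊃-wellFounded)

Maximal : (VSet n → Set) → VSet n → Set
Maximal P S = P S × (∀ T → P T → S ⊆ₛ T → T ⊆ₛ S)

-- Maximality is not decidable, so constructively only the double negation holds; it suffices
-- because the goals it is used for (adjacency) are decidable.
¬¬-maximal-above : (P : VSet n → Set) → P S → ¬ ¬ (∃ λ T → Maximal P T × S ⊆ₛ T)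
¬¬-maximal-above P = go (⊃ₛ-wellFounded _)
  where
  go : Acc (flip _⊂ₛ_) S → P S → ¬ ¬ (∃ λ T → Maximal P T × S ⊆ₛ T)
  go {S = S} (acc rec) PS no-max = no-max (S , (PS , maximal) , λ _ v∈S → v∈S)
    where
    maximal : ∀ T → P T → S ⊆ₛ T → T ⊆ₛ S
    maximal T PT S⊆T v v∈T = decidable-stable (S v ≟ᵇ true) λ v∉S →
      go (rec (S⊆T , v , v∈T , v∉S)) PT λ (U , max-U , T⊆U) →
        no-max (U , max-U , λ x → T⊆U x ∘ S⊆T x)

count : (Fin n → Bool) → ℕ
count f = sum (tabulate (λ v → if f v then 1 else 0))

1≤count⇒∃ : (f : Fin n → Bool) → 1 ≤ count f → ∃ λ a → f a ≡ true
1≤count⇒∃ {suc n} f 1≤c with f zero in fa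
... | true  = zero , fa
... | false with 1≤count⇒∃ (f ∘ suc) 1≤c
...   | a , fsa = suc a , fsa

∃⇒1≤count : (f : Fin n → Bool) → f u ≡ true → 1 ≤ count f
∃⇒1≤count {u = zero}  f fu rewrite fu = s≤s z≤n
∃⇒1≤count {u = suc u} f fu with f zero
... | true  = s≤s z≤n
... | false = ∃⇒1≤count (f ∘ suc) fu

2≤count⇔∃₂ : (f : Fin n → Bool) → 2 ≤ count f ⇔ (∃₂ λ a b → a ≢ b × f a ≡ true × f b ≡ true)
2≤count⇔∃₂ f = mk⇔ (to f) (λ (a , b , a≢b , fa , fb) → from f a≢b fa fb)
  where
  to : (f : Fin n → Bool) → 2 ≤ count f → ∃₂ λ a b → a ≢ b × f a ≡ true × f b ≡ true
  to {suc n} f 2≤c with f zero in f0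
  ... | true with 1≤count⇒∃ (f ∘ suc) (s≤s⁻¹ 2≤c)
  ...   | b , fb = zero , suc b , (λ ()) , f0 , fb
  to {suc n} f 2≤c | false with to (f ∘ suc) 2≤c
  ...   | a , b , a≢b , fa , fb = suc a , suc b , a≢b ∘ suc-injective , fa , fb

  from : (f : Fin n → Bool) → u ≢ v → f u ≡ true → f v ≡ true → 2 ≤ count f
  from {u = zero}  {zero}  f u≢v _  _  = contradiction refl u≢v
  from {u = zero}  {suc v} f _   fu fv rewrite fu = s≤s (∃⇒1≤count (f ∘ suc) fv)
  from {u = suc u} {zero}  f _   fu fv rewrite fv = s≤s (∃⇒1≤count (f ∘ suc) fu)
  from {u = suc u} {suc v} f u≢v fu fv with f zero
  ... | true  = s≤s (∃⇒1≤count (f ∘ suc) fu)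
  ... | false = from (f ∘ suc) (u≢v ∘ cong suc) fu fv

source∈ₛ : ∀ {G : Graph n} {x y} → ConnIn G S x y → x ∈ₛ S
source∈ₛ (here x∈S)     = x∈S
source∈ₛ (step x∈S _ _) = x∈S

module _ (G : Graph n) where

  edge-sym : Edge G u v → Edge G v u
  edge-sym {u} {v} u~v = trans (sym G v u) u~v

  edge⇒≢ : Edge G u v → u ≢ v
  edge⇒≢ {u} u~u refl = contradiction (trans (≡-sym u~u) (irrefl G u)) λ ()

  2≤deg⇔two-neighbours : 2 ≤ deg G v ⇔ (∃₂ λ a b → a ≢ b × Edge G v a × Edge G v b)
  2≤deg⇔two-neighbours {v} rewrite map-tabulate id (λ u → if adj G v u then 1 else 0) =
    2≤count⇔∃₂ (adj G v)

  module _ {K T : VSet n} (K-clique : IsClique G K)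
           (anchor : ∀ x → x ∈ₛ T → K x ≡ false → ∃ λ m → m ∈ₛ T × m ∈ₛ K × Edge G x m) where

    private
      through-clique : ∀ {k m z} → k ∈ₛ T → k ∈ₛ K → m ∈ₛ T → m ∈ₛ K
                     → ConnIn G T m z → ConnIn G T k z
      through-clique {k} {m} k∈T k∈K m∈T m∈K m⇝z with k ≟ m
      ... | yes refl = m⇝z
      ... | no k≢m   = step k∈T (K-clique k m k∈K m∈K k≢m) m⇝z

      from-clique : ∀ {k y} → k ∈ₛ T → k ∈ₛ K → y ∈ₛ T → ConnIn G T k y
      from-clique {y = y} k∈T k∈K y∈T with K y in y∈K
      ... | true  = through-clique k∈T k∈K y∈T y∈K (here y∈T)
      ... | false with anchor y y∈T y∈K
      ...   | m , m∈T , m∈K , y~m =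
        through-clique k∈T k∈K m∈T m∈K (step m∈T (edge-sym y~m) (here y∈T))

    connected-around-clique : ConnectedSet G T
    connected-around-clique x y x∈T y∈T with K x in x∈K
    ... | true  = from-clique x∈T x∈K y∈T
    ... | false with anchor x x∈T x∈K
    ...   | m , m∈T , m∈K , x~m = step x∈T x~m (from-clique m∈T m∈K y∈T)

  biconnected-around-clique : ∀ {K T : VSet n} → IsClique G K → K ⊆ₛ T → (∃ λ v → v ∈ₛ T)
    → (∀ x → x ∈ₛ T → K x ≡ false → ∃₂ λ a b → a ≢ b × a ∈ₛ K × b ∈ₛ K × Edge G x a × Edge G x b)
    → Biconnected G T
  biconnected-around-clique {K} {T} K-clique K⊆T nonempty two-in-K =
    nonempty ,
    connected-around-clique K-clique anchor ,
    λ z _ → connected-around-clique K-clique (anchor-∖ z)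
    where
    anchor : ∀ x → x ∈ₛ T → K x ≡ false → ∃ λ m → m ∈ₛ T × m ∈ₛ K × Edge G x m
    anchor x x∈T x∉K with two-in-K x x∈T x∉K
    ... | a , _ , _ , a∈K , _ , x~a , _ = a , K⊆T a a∈K , a∈K , x~a

    anchor-∖ : ∀ z x → x ∈ₛ (T ∖ₛ z) → K x ≡ false → ∃ λ m → m ∈ₛ (T ∖ₛ z) × m ∈ₛ K × Edge G x m
    anchor-∖ z x x∈T∖z x∉K with two-in-K x (proj₁ (∈-∖ₛ⁻ T x∈T∖z)) x∉K
    ... | a , b , a≢b , a∈K , b∈K , x~a , x~b with a ≟ z
    ...   | yes refl = b , ∈-∖ₛ T (K⊆T b b∈K) (a≢b ∘ ≡-sym) , b∈K , x~b
    ...   | no a≢z   = a , ∈-∖ₛ T (K⊆T a a∈K) a≢z , a∈K , x~a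

  -- A walk from u to w leaves u along some edge u~y; since y ≠ w, deleting y leaves another walk,
  -- which leaves u along a second edge.
  nonadjacent⇒2≤deg : Biconnected G S → u ∈ₛ S → w ∈ₛ S → u ≢ w → ¬ Edge G u w → 2 ≤ deg G u
  nonadjacent⇒2≤deg {S = S} {u = u} {w} (_ , connected , cut-free) u∈S w∈S u≢w u≁w
    with connected u w u∈S w∈S
  ... | here _ = contradiction refl u≢w
  ... | step {y = y} _ u~y y⇝w
    with cut-free y (source∈ₛ y⇝w) u w (∈-∖ₛ S u∈S (edge⇒≢ u~y)) (∈-∖ₛ S w∈S λ { refl → u≁w u~y })
  ...   | here _ = contradiction refl u≢w
  ...   | step {y = y′} _ u~y′ y′⇝w =
    Equivalence.from 2≤deg⇔two-neighbours (y′ , y , proj₂ (∈-∖ₛ⁻ S (source∈ₛ y′⇝w)) , u~y′ , u~y)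

  biconnected⇒clique : IsBlockGraph G → Biconnected G S → IsClique G S
  biconnected⇒clique block-graph S-biconnected u w u∈S w∈S u≢w =
    decidable-stable (adj G u w ≟ᵇ true) λ u≁w →
      ¬¬-maximal-above (Biconnected G) S-biconnected λ (B , B-block , S⊆B) →
        u≁w (block-graph B B-block u w (S⊆B u u∈S) (S⊆B w w∈S) u≢w)

HighDegreeIComplete : Graph n → VSet n → Set
HighDegreeIComplete G C = ∀ v → C v ≡ false → 2 ≤ deg G v → ∀ u → C u ≡ true → Edge G v u

AtMostOneHighDegreeI : Graph n → VSet n → Set
AtMostOneHighDegreeI G C = ∀ v w → C v ≡ false → C w ≡ false → 2 ≤ deg G v → 2 ≤ deg G w → v ≡ w

module SplitGraph (G : Graph n) (C : VSet n)
                  (C-clique : IsClique G C) (I-independent : IsIndependent G (compl C)) where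

  I-neighbour∈C : C v ≡ false → Edge G v u → u ∈ₛ C
  I-neighbour∈C {v} {u} v∈I v~u with C u in Cu
  ... | true  = refl
  ... | false = contradiction v~u (I-independent v u (cong not v∈I) (cong not Cu))

  C+v+w-biconnected : C v ≡ false → C w ≡ false → 2 ≤ deg G v → 2 ≤ deg G w
    → Biconnected G (insert v (insert w C))
  C+v+w-biconnected {v} {w} v∈I w∈I 2≤deg-v 2≤deg-w =
    biconnected-around-clique G C-clique
      (λ x → ∈-insert-there v (insert w C) ∘ ∈-insert-there w C)
      (v , ∈-insert-here v (insert w C))
      two-in-C
    where
    neighbours-in-C : ∀ {x} → C x ≡ false → 2 ≤ deg G x
      → ∃₂ λ a b → a ≢ b × a ∈ₛ C × b ∈ₛ C × Edge G x a × Edge G x b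
    neighbours-in-C x∈I 2≤deg-x with Equivalence.to (2≤deg⇔two-neighbours G) 2≤deg-x
    ... | a , b , a≢b , x~a , x~b =
      a , b , a≢b , I-neighbour∈C x∈I x~a , I-neighbour∈C x∈I x~b , x~a , x~b

    two-in-C : ∀ x → x ∈ₛ insert v (insert w C) → C x ≡ false
      → ∃₂ λ a b → a ≢ b × a ∈ₛ C × b ∈ₛ C × Edge G x a × Edge G x b
    two-in-C x x∈ x∈I with ∈-insert⁻ x v (insert w C) x∈
    ... | inj₁ refl = neighbours-in-C v∈I 2≤deg-v
    ... | inj₂ x∈′ with ∈-insert⁻ x w C x∈′
    ...   | inj₁ refl = neighbours-in-C w∈I 2≤deg-w
    ...   | inj₂ x∈C  = contradiction (trans (≡-sym x∈I) x∈C) λ ()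

  block-graph⇒high-degree-I-complete : IsBlockGraph G → HighDegreeIComplete G C
  block-graph⇒high-degree-I-complete block-graph v v∈I 2≤deg-v u u∈C =
    biconnected⇒clique G block-graph (C+v+w-biconnected v∈I v∈I 2≤deg-v 2≤deg-v) v u
      (∈-insert-here v (insert v C))
      (∈-insert-there {u = u} v (insert v C) (∈-insert-there v C u∈C))
      v≢u
    where
    v≢u : v ≢ u
    v≢u refl = contradiction (trans (≡-sym v∈I) u∈C) λ ()

  block-graph⇒at-most-one-high-degree-I : IsBlockGraph G → AtMostOneHighDegreeI G C
  block-graph⇒at-most-one-high-degree-I block-graph v w v∈I w∈I 2≤deg-v 2≤deg-w =
    decidable-stable (v ≟ w) λ v≢w →
      I-independent v w (cong not v∈I) (cong not w∈I)
        (biconnected⇒clique G block-graph (C+v+w-biconnected v∈I w∈I 2≤deg-v 2≤deg-w) v w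
          (∈-insert-here v (insert w C))
          (∈-insert-there {u = w} v (insert w C) (∈-insert-here w C))
          v≢w)

  conditions⇒block-graph : HighDegreeIComplete G C → AtMostOneHighDegreeI G C → IsBlockGraph G
  conditions⇒block-graph I-complete one-I S (S-biconnected , _) u w u∈S w∈S u≢w =
    decidable-stable (adj G u w ≟ᵇ true) λ u≁w →
      u≁w (adjacent-by-sides
        (nonadjacent⇒2≤deg G S-biconnected u∈S w∈S u≢w u≁w)
        (nonadjacent⇒2≤deg G S-biconnected w∈S u∈S (u≢w ∘ ≡-sym) (u≁w ∘ edge-sym G)))
    where
    adjacent-by-sides : 2 ≤ deg G u → 2 ≤ deg G w → Edge G u w
    adjacent-by-sides 2≤deg-u 2≤deg-w with C u in Cu | C w in Cw
    ... | true  | true  = C-clique u w Cu Cw u≢w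
    ... | false | true  = I-complete u Cu 2≤deg-u w Cw
    ... | true  | false = edge-sym G (I-complete w Cw 2≤deg-w u Cu)
    ... | false | false = contradiction (one-I u w Cu Cw 2≤deg-u 2≤deg-w) u≢w

lemma1 : ∀ {n} (G : Graph n) (C : VSet n)
         → IsClique G C → IsIndependent G (compl C)
         → IsBlockGraph G ⇔
           ((∀ v → C v ≡ false → 2 ≤ deg G v → ∀ u → C u ≡ true → Edge G v u)
            × (∀ v w → C v ≡ false → C w ≡ false → 2 ≤ deg G v → 2 ≤ deg G w → v ≡ w))
lemma1 G C C-clique I-independent = mk⇔
  (λ block-graph → block-graph⇒high-degree-I-complete block-graph
                 , block-graph⇒at-most-one-high-degree-I block-graph)
  (λ (I-complete , one-I) → conditions⇒block-graph I-complete one-I)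
  where open SplitGraph G C C-clique I-independent
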